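{- Let $n \geq 1$ and let $V$ be a set of $n$ variables. The maximum number of times a literal (a variable in $V$ or its complement) can appear in a Boolean formula in Precise Conjunctive Normal Form whose variables are among $V$ is $p(n) = 3^{n-1}$.
   Context: A literal is a variable $x$ or its complement $\sim x$. A clause is a (nonempty) disjunction of literals; a formula in conjunctive normal form is a conjunction of clauses. A Boolean formula is in Precise Conjunctive Normal Form (PCNF) if it is a conjunction of pairwise distinct clauses, where each clause is a disjunction of pairwise distinct literals and no clause contains both a variable and its complement. Clauses are identified as sets of literals. -}

module Defs where

open import Data.Nat using (ℕ)
open import Data.Fin using (Fin)
open import Data.Fin.Properties using () renaming (_≟_ to _≟ᶠ_)
open import Data.Bool using (Bool; true; false; not)
open import Data.Bool.Properties using () renaming (_≟_ to _≟ᵇ_)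
open import Data.Product using (_×_; _,_)
open import Data.Product.Properties using (≡-dec)
open import Data.List using (List; []; _∷_; length; filter)
open import Data.List.Relation.Unary.Unique.Propositional using (Unique)
open import Data.List.Relation.Unary.AllPairs using (AllPairs)
open import Data.List.Membership.Propositional using (_∈_)
open import Data.List.Membership.DecPropositional using () renaming (_∈?_ to ∈?-gen)
open import Relation.Binary.PropositionalEquality using (_≡_)
open import Relation.Binary.Definitions using (DecidableEquality)
open import Relation.Nullary using (¬_)
open import Function.Bundles using (_⇔_)

-- A literal over the variable set V = Fin n: a variable together with a
-- polarity (true = the variable x itself, false = its complement ∼x).
Literal : ℕ → Set
Literal n = Fin n × Bool

∼_ : ∀ {n} → Literal n → Literal n
∼ (x , b) = (x , not b)

_≟ˡ_ : ∀ {n} → DecidableEquality (Literal n)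
_≟ˡ_ = ≡-dec _≟ᶠ_ _≟ᵇ_

-- A clause is a disjunction of literals, identified with its set of literals;
-- we represent it as a list of literals.
Clause : ℕ → Set
Clause n = List (Literal n)

CNF : ℕ → Set
CNF n = List (Clause n)

_≈ᶜ_ : ∀ {n} → Clause n → Clause n → Set
C ≈ᶜ D = ∀ l → (l ∈ C) ⇔ (l ∈ D)

record PreciseClause {n : ℕ} (C : Clause n) : Set where
  field
    nonempty      : ¬ (C ≡ [])
    distinctLits  : Unique C
    noComplement  : ∀ l → l ∈ C → ¬ ((∼ l) ∈ C)

record PCNF {n : ℕ} (F : CNF n) : Set where
  field
    clausesPrecise  : ∀ C → C ∈ F → PreciseClause C
    clausesDistinct : AllPairs (λ C D → ¬ (C ≈ᶜ D)) F

-- Number of times the literal l appears in F: the number of clauses of F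
-- containing l (a literal occurs at most once in a precise clause).
occurrences : ∀ {n} → Literal n → CNF n → ℕ
occurrences l F = length (filter (λ C → ∈?-gen _≟ˡ_ l C) F)

{-# OPTIONS --safe #-}
-- A precise clause is determined, up to set equality, by its status vector:
-- for each variable whether it occurs positively, negatively or not at all.
-- The clauses containing a literal of the variable v all have the same status
-- at v, so they are told apart by their status at the other n - 1 variables,
-- which leaves at most 3^(n-1) of them. Conversely, the clauses containing
-- x₀ with an arbitrary status at every other variable form a PCNF formula in
-- which x₀ occurs 3^(n-1) times.
module Submission where

open import Defs
open import Data.Nat using (ℕ; _≤_; _^_; _∸_)
open import Data.Product using (_×_; Σ; _,_)
open import Relation.Binary.PropositionalEquality using (_≡_)

open import Data.Nat using (zero; suc)
open import Data.Fin using (Fin; zero; suc; _≟_; punchIn; punchOut; funToFin; finToFun; combine)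
open import Data.Fin.Properties using (injective⇒≤; punchIn-punchOut; finToFun-funToFin; funToFin-finToFin)
open import Data.Bool using (Bool; true; false; not)
open import Data.Product using (proj₁; proj₂)
open import Data.Empty using (⊥-elim)
open import Data.List using (List; []; _∷_; length; filter; map; allFin; lookup; cartesianProduct)
open import Data.List.Properties using (length-map; length-tabulate; filter-all)
open import Data.List.Relation.Unary.All as All using (All; []; _∷_)
open import Data.List.Relation.Unary.Any using (here; there)
open import Data.List.Relation.Unary.AllPairs as AllPairs using (AllPairs; []; _∷_)
import Data.List.Relation.Unary.AllPairs.Properties as AllPairs
import Data.List.Relation.Unary.All.Properties as All
open import Data.List.Relation.Unary.Unique.Propositional using (Unique)
import Data.List.Relation.Unary.Unique.Propositional.Properties as Unique
open import Data.List.Membership.Propositional using (_∈_)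
open import Data.List.Membership.Propositional.Properties
  using (∈-lookup; ∈-filter⁺; ∈-filter⁻; ∈-allFin; ∈-cartesianProduct⁺)
open import Data.List.Membership.DecPropositional using () renaming (_∈?_ to ∈?-with)
import Data.Vec.Functional as Vector
open import Relation.Binary.PropositionalEquality using (_≢_; refl; sym; trans; cong; cong₂; subst; module ≡-Reasoning)
open import Relation.Nullary using (¬_; Dec; yes; no; contradiction)
open import Function using (_∘_; id)
open import Function.Bundles using (_⇔_; mk⇔; Equivalence)
open Equivalence using (to; from)
import Function.Properties.Equivalence as ⇔

private
  variable
    A : Set
    k m n : ℕ

unique-length≤ : {xs : List (Fin k)} → Unique xs → length xs ≤ k
unique-length≤ u = injective⇒≤ (lookup-injective u)
  where
  lookup-injective : ∀ {ys : List A} → Unique ys → ∀ {i j} → lookup ys i ≡ lookup ys j → i ≡ j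
  lookup-injective (_ ∷ _)    {zero}  {zero}  _  = refl
  lookup-injective (px ∷ _)   {zero}  {suc j} eq = contradiction eq (All.lookup px (∈-lookup j))
  lookup-injective (px ∷ _)   {suc i} {zero}  eq = contradiction (sym eq) (All.lookup px (∈-lookup i))
  lookup-injective (_ ∷ pxs)  {suc i} {suc j} eq = cong suc (lookup-injective pxs eq)

AllPairs-restrict : {P : A → Set} {R S : A → A → Set} →
  (∀ {x y} → P x → P y → R x y → S x y) →
  {xs : List A} → All P xs → AllPairs R xs → AllPairs S xs
AllPairs-restrict f [] [] = []
AllPairs-restrict f (px ∷ pxs) (rx ∷ rxs) =
  All.zipWith (λ (py , r) → f px py r) (pxs , rx) ∷ AllPairs-restrict f pxs rxs

funToFin-cong : {f g : Fin m → Fin k} → (∀ i → f i ≡ g i) → funToFin f ≡ funToFin g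
funToFin-cong {zero}  _   = refl
funToFin-cong {suc m} f≗g = cong₂ combine (f≗g zero) (funToFin-cong (f≗g ∘ suc))

finToFun-injective : {t u : Fin (k ^ m)} → (∀ (i : Fin m) → finToFun t i ≡ finToFun u i) → t ≡ u
finToFun-injective {k} {m} {t} {u} eq =
  trans (sym (funToFin-finToFin {m} {k} t))
        (trans (funToFin-cong {f = finToFun t} eq) (funToFin-finToFin {m} {k} u))

funToFin-injective : {f g : Fin m → Fin k} → funToFin f ≡ funToFin g → ∀ i → f i ≡ g i
funToFin-injective {f = f} {g} eq i =
  trans (sym (finToFun-funToFin f i)) (trans (cong (λ t → finToFun t i) eq) (finToFun-funToFin g i))

-- Statuses are coded in Fin 3 so that status vectors over m variables are
-- counted by funToFin : (Fin m → Fin 3) → Fin (3 ^ m).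
Status : Set
Status = Fin 3

pattern positive = zero
pattern negative = suc zero
pattern absent   = suc (suc zero)

polarity : Bool → Status
polarity true  = positive
polarity false = negative

polarity-not : ∀ b → polarity (not b) ≢ polarity b
polarity-not true  ()
polarity-not false ()

Status-ext : {s t : Status} → (∀ b → s ≡ polarity b ⇔ t ≡ polarity b) → s ≡ t
Status-ext {positive}         e = sym (to (e true) refl)
Status-ext {negative}         e = sym (to (e false) refl)
Status-ext {absent} {positive} e = from (e true) refl
Status-ext {absent} {negative} e = from (e false) refl
Status-ext {absent} {absent}   e = refl

_∈?_ : (l : Literal n) (C : Clause n) → Dec (l ∈ C)
l ∈? C = ∈?-with _≟ˡ_ l C

ComplementFree : Clause n → Set
ComplementFree C = ∀ l → l ∈ C → ¬ ((∼ l) ∈ C)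

status : Fin n → Clause n → Status
status x C with (x , true) ∈? C | (x , false) ∈? C
... | yes _ | _     = positive
... | no _  | yes _ = negative
... | no _  | no _  = absent

∈⇔status : {C : Clause n} → ComplementFree C → ∀ x b → (x , b) ∈ C ⇔ status x C ≡ polarity b
∈⇔status {C = C} cf x b with (x , true) ∈? C | (x , false) ∈? C
∈⇔status cf x true  | yes p | _      = mk⇔ (λ _ → refl) (λ _ → p)
∈⇔status cf x false | yes p | _      = mk⇔ (λ q → ⊥-elim (cf _ p q)) (λ ())
∈⇔status cf x true  | no ¬p | yes _  = mk⇔ (⊥-elim ∘ ¬p) (λ ())
∈⇔status cf x false | no _  | yes q  = mk⇔ (λ _ → refl) (λ _ → q)
∈⇔status cf x true  | no ¬p | no _   = mk⇔ (⊥-elim ∘ ¬p) (λ ())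
∈⇔status cf x false | no _  | no ¬q  = mk⇔ (⊥-elim ∘ ¬q) (λ ())

status-injective : {C D : Clause n} → ComplementFree C → ComplementFree D →
  (∀ x → status x C ≡ status x D) → C ≈ᶜ D
status-injective cfC cfD eq (x , b) = mk⇔
  (λ p → from (∈⇔status cfD x b) (trans (sym (eq x)) (to (∈⇔status cfC x b) p)))
  (λ q → from (∈⇔status cfC x b) (trans (eq x) (to (∈⇔status cfD x b) q)))

signature : Fin (suc m) → Clause (suc m) → Fin (3 ^ m)
signature v C = funToFin (λ i → status (punchIn v i) C)

signature-injective : ∀ {v b} {C D : Clause (suc m)} → ComplementFree C → ComplementFree D →
  (v , b) ∈ C → (v , b) ∈ D → signature v C ≡ signature v D → C ≈ᶜ D
signature-injective {v = v} {b} {C} {D} cfC cfD vC vD eq = status-injective cfC cfD agree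
  where
  agree : ∀ x → status x C ≡ status x D
  agree x with v ≟ x
  ... | yes refl = trans (to (∈⇔status cfC v b) vC) (sym (to (∈⇔status cfD v b) vD))
  ... | no v≢x   = subst (λ y → status y C ≡ status y D) (punchIn-punchOut v≢x)
                         (funToFin-injective eq (punchOut v≢x))

occurrences-≤ : {F : CNF (suc m)} → PCNF F → ∀ l → occurrences l F ≤ 3 ^ m
occurrences-≤ {m} {F} pcnf l@(v , b) =
  subst (_≤ 3 ^ m) (length-map (signature v) G) (unique-length≤ signatures-unique)
  where
  open PCNF pcnf
  G = filter (l ∈?_) F
  complementFree : ∀ {C} → C ∈ G → ComplementFree C
  complementFree p = PreciseClause.noComplement (clausesPrecise _ (proj₁ (∈-filter⁻ (l ∈?_) {xs = F} p)))
  contains : ∀ {C} → C ∈ G → l ∈ C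
  contains p = proj₂ (∈-filter⁻ (l ∈?_) {xs = F} p)
  distinct : ∀ {C D} → C ∈ G → D ∈ G → ¬ (C ≈ᶜ D) → signature v C ≢ signature v D
  distinct pC pD C≉D = C≉D ∘ signature-injective (complementFree pC) (complementFree pD)
                                                 (contains pC) (contains pD)
  signatures-unique : Unique (map (signature v) G)
  signatures-unique = AllPairs.map⁺
    (AllPairs-restrict distinct (All.tabulate id) (AllPairs.filter⁺ (l ∈?_) clausesDistinct))

allLiterals : ∀ n → List (Literal n)
allLiterals n = cartesianProduct (allFin n) (true ∷ false ∷ [])

∈-allLiterals : (l : Literal n) → l ∈ allLiterals n
∈-allLiterals (x , true)  = ∈-cartesianProduct⁺ (∈-allFin x) (here refl)
∈-allLiterals (x , false) = ∈-cartesianProduct⁺ (∈-allFin x) (there (here refl))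

allLiterals-unique : Unique (allLiterals n)
allLiterals-unique {n} = Unique.cartesianProduct⁺ (Unique.allFin⁺ n) (((λ ()) ∷ []) ∷ [] ∷ [])

clauseOf : (Fin n → Status) → Clause n
clauseOf {n} s = filter (λ l → s (proj₁ l) ≟ polarity (proj₂ l)) (allLiterals n)

∈-clauseOf : ∀ {s : Fin n → Status} x b → (x , b) ∈ clauseOf s ⇔ s x ≡ polarity b
∈-clauseOf {n} x b = mk⇔ (proj₂ ∘ ∈-filter⁻ _ {xs = allLiterals n}) (∈-filter⁺ _ (∈-allLiterals (x , b)))

clauseOf-precise : ∀ {s : Fin n → Status} x b → s x ≡ polarity b → PreciseClause (clauseOf s)
clauseOf-precise x b sx = record
  { nonempty     = λ C≡[] → contradiction (subst ((x , b) ∈_) C≡[] (from (∈-clauseOf x b) sx)) λ ()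
  ; distinctLits = Unique.filter⁺ _ allLiterals-unique
  ; noComplement = λ (y , c) p q →
      polarity-not c (trans (sym (to (∈-clauseOf y (not c)) q)) (to (∈-clauseOf y c) p))
  }

clauseOf-injective : {s t : Fin n → Status} → clauseOf s ≈ᶜ clauseOf t → ∀ x → s x ≡ t x
clauseOf-injective e x = Status-ext λ b →
  ⇔.trans (⇔.sym (∈-clauseOf x b)) (⇔.trans (e (x , b)) (∈-clauseOf x b))

extremalStatus : ∀ m → Fin (3 ^ m) → Fin (suc m) → Status
extremalStatus m t = positive Vector.∷ finToFun t

extremalClause : ∀ m → Fin (3 ^ m) → Clause (suc m)
extremalClause m t = clauseOf (extremalStatus m t)

x₀∈extremalClause : ∀ m t → (zero , true) ∈ extremalClause m t
x₀∈extremalClause m t = from (∈-clauseOf {s = extremalStatus m t} zero true) refl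

extremal : ∀ m → CNF (suc m)
extremal m = map (extremalClause m) (allFin (3 ^ m))

extremal-PCNF : ∀ {m} → PCNF (extremal m)
extremal-PCNF {m} = record
  { clausesPrecise  = λ _ → All.lookup {P = PreciseClause}
                              (All.map⁺ {f = extremalClause m} (All.universal precise _))
  ; clausesDistinct = AllPairs.map⁺ (AllPairs.map (λ t≢u → t≢u ∘ distinct) (Unique.allFin⁺ _))
  }
  where
  distinct : ∀ {t u} → extremalClause m t ≈ᶜ extremalClause m u → t ≡ u
  distinct {t} {u} e = finToFun-injective {3} {m}
    (clauseOf-injective {s = extremalStatus m t} {extremalStatus m u} e ∘ suc)
  precise : ∀ t → PreciseClause (extremalClause m t)
  precise t = clauseOf-precise {s = extremalStatus m t} zero true refl

extremal-occurrences : ∀ {m} → occurrences (zero , true) (extremal m) ≡ 3 ^ m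
extremal-occurrences {m} = begin
  length (filter ((zero , true) ∈?_) (extremal m)) ≡⟨ cong length (filter-all ((zero , true) ∈?_) containsX₀) ⟩
  length (extremal m)                              ≡⟨ length-map (extremalClause m) (allFin (3 ^ m)) ⟩
  length (allFin (3 ^ m))                          ≡⟨ length-tabulate id ⟩
  3 ^ m                                            ∎
  where
  open ≡-Reasoning
  containsX₀ : All ((zero , true) ∈_) (extremal m)
  containsX₀ = All.map⁺ {f = extremalClause m} (All.universal (x₀∈extremalClause m) _)

corollary2 : (n : ℕ) → 1 ≤ n →
    ((F : CNF n) → PCNF F → (l : Literal n) → occurrences l F ≤ 3 ^ (n ∸ 1))
    × Σ (CNF n) (λ F → PCNF F × Σ (Literal n) (λ l → occurrences l F ≡ 3 ^ (n ∸ 1)))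
corollary2 (suc m) _ = (λ _ → occurrences-≤) , extremal m , extremal-PCNF , (zero , true) , extremal-occurrences {m}
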